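{- Let $F$ be a finite family of proper arcs on a circle (no arc of $F$ is properly contained in another arc of $F$; all arc endpoints are distinct; no arc is the whole circle or a single point). Let $r_{sup}$ be the maximum and $r_{inf}$ the minimum, over points $p$ of the circle, of the number of arcs of $F$ containing $p$. Then for every arc $u \in F$, the number of arcs $v \in F$, $v\neq u$, that are clockwise adjacent to $u$ is at most $r_{sup}-1$ and at least $r_{inf}$; likewise the number of arcs $v\in F$, $v\neq u$, that are anticlockwise adjacent to $u$ is at most $r_{sup}-1$ and at least $r_{inf}$.
   Context: Arcs are closed. For a point $p$ on the circle, the overlap set $\mathcal{O}(p)$ is the set of arcs of $F$ containing $p$; $r_{sup}=\max_p|\mathcal{O}(p)|$ and $r_{inf}=\min_p|\mathcal{O}(p)|$. For an arc $u$, its left endpoint $l(u)$ (resp. right endpoint $r(u)$) is the first endpoint of $u$ met when traversing anticlockwise (resp. clockwise) from an interior point of $u$. An arc $v$ is clockwise adjacent to $u$ if $v\in\mathcal{O}(r(u))$, and anticlockwise adjacent to $u$ if $v\in\mathcal{O}(l(u))$.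
   Formalization: Points of the circle, including all arc endpoints and the points $p$ over which $r_{sup}$ and $r_{inf}$ are taken, are rational, the circle being taken as ℚ ∩ [0,1) with clockwise as increasing. -}

module Defs where

open import Data.Nat using (ℕ; zero; suc)
open import Data.Fin using (Fin; zero; suc)
open import Data.Bool using (Bool; true; false; _∧_)
open import Data.Product using (_×_; _,_)
open import Data.Sum using (_⊎_)
open import Data.Rational using (ℚ; 0ℚ; 1ℚ; _≤_; _<_)
open import Data.Rational.Properties using (_≤?_; _<?_)
open import Relation.Nullary using (¬_; Dec; does)
open import Relation.Nullary.Decidable using (_×-dec_; _⊎-dec_; ¬?)
open import Relation.Binary.PropositionalEquality using (_≡_)

-- The circle is modelled as ℚ ∩ [0,1) (i.e. ℚ/ℤ), with increasing
-- coordinate = clockwise direction (wrapping from 1 back to 0).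
OnCircle : ℚ → Set
OnCircle p = (0ℚ ≤ p) × (p < 1ℚ)

-- A closed arc, given by its left endpoint l (first endpoint met going
-- anticlockwise from an interior point) and right endpoint r; the arc is
-- the set of points met going clockwise from l to r.
record Arc : Set where
  constructor arc
  field
    l : ℚ
    r : ℚ
open Arc public

_∋_ : Arc → ℚ → Set
a ∋ p = ((l a < r a) × ((l a ≤ p) × (p ≤ r a)))
      ⊎ ((r a < l a) × ((l a ≤ p) ⊎ (p ≤ r a)))

_∋?_ : (a : Arc) → (p : ℚ) → Dec (a ∋ p)
a ∋? p = ((l a <? r a) ×-dec ((l a ≤? p) ×-dec (p ≤? r a)))
       ⊎-dec ((r a <? l a) ×-dec ((l a ≤? p) ⊎-dec (p ≤? r a)))

count : ∀ {n} → (Fin n → Bool) → ℕ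
count {zero} f = 0
count {suc n} f with f zero
... | true = suc (count (λ i → f (suc i)))
... | false = count (λ i → f (suc i))

_⊆ᵃ_ : Arc → Arc → Set
u ⊆ᵃ v = ∀ p → OnCircle p → u ∋ p → v ∋ p

record ProperFamily {n : ℕ} (F : Fin n → Arc) : Set where
  field
    l-on : ∀ i → OnCircle (l (F i))
    r-on : ∀ i → OnCircle (r (F i))
    -- all 2n endpoints are pairwise distinct (in particular l ≠ r, so
    -- no arc is a single point or the whole circle)
    l-distinct : ∀ i j → l (F i) ≡ l (F j) → i ≡ j
    r-distinct : ∀ i j → r (F i) ≡ r (F j) → i ≡ j
    lr-distinct : ∀ i j → ¬ (l (F i) ≡ r (F j))
    no-proper : ∀ i j → ¬ ((F i ⊆ᵃ F j) × ¬ (F j ⊆ᵃ F i))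

overlapCount : ∀ {n} → (Fin n → Arc) → ℚ → ℕ
overlapCount F p = count (λ i → does (F i ∋? p))

cwAdjCount : ∀ {n} → (Fin n → Arc) → Fin n → ℕ
cwAdjCount F u = count (λ v → does (¬? (v Data.Fin.≟ u)) ∧ does (F v ∋? r (F u)))

acwAdjCount : ∀ {n} → (Fin n → Arc) → Fin n → ℕ
acwAdjCount F u = count (λ v → does (¬? (v Data.Fin.≟ u)) ∧ does (F v ∋? l (F u)))

IsRsup : ∀ {n} → (Fin n → Arc) → ℕ → Set
IsRsup F m = (∀ p → OnCircle p → overlapCount F p Data.Nat.≤ m)
           × Data.Product.∃ (λ p → OnCircle p × (overlapCount F p ≡ m))

IsRinf : ∀ {n} → (Fin n → Arc) → ℕ → Set
IsRinf F m = (∀ p → OnCircle p → m Data.Nat.≤ overlapCount F p)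
           × Data.Product.∃ (λ p → OnCircle p × (overlapCount F p ≡ m))

{-# OPTIONS --safe #-}
module Submission where

-- Upper bounds: the arcs containing an endpoint of u include u itself, and there
-- are at most r_sup of them.  Lower bounds: every arc containing a point p just
-- clockwise of r(u) (resp. anticlockwise of l(u)), with no endpoint in between,
-- also contains r(u) (resp. l(u)) and differs from u; at least r_inf arcs contain p.
-- As the circle is coded as [0,1), for l(u) = 0 that point lies just below 1.

open import Defs
open import Data.Nat using (ℕ; _≤_; _∸_; zero; suc; s≤s; z≤n)
open import Data.Nat.Properties using (m≤n⇒m≤1+n; ∸-monoˡ-≤)
import Data.Nat.Properties as ℕₚ
open import Data.Fin using (Fin; zero; suc; _≟_)
open import Data.Bool using (Bool; true; false; T; _∧_)
open import Data.Bool.Properties using (T-∧)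
open import Data.Product using (_×_; _,_; ∃-syntax; proj₁; proj₂)
open import Data.Sum using (_⊎_; inj₁; inj₂; [_,_]′; map₂)
open import Data.Empty using (⊥-elim)
open import Data.Unit using (tt)
open import Data.Rational using (ℚ; 0ℚ; 1ℚ) renaming (_≤_ to _≤ℚ_; _<_ to _<ℚ_)
open import Data.Rational.Properties
  using (_≤?_; _<?_; <-dense; ≤-refl; <-trans; <-≤-trans; ≤-<-trans;
         <⇒≤; ≮⇒≥; ≰⇒>; <⇒≢; <-irrefl; <-cmp; ≤-antisym; positive⁻¹)
open import Function using (_∘_; id)
open import Function.Bundles using (Equivalence)
open import Relation.Binary.Definitions using (tri<; tri≈; tri>)
open import Relation.Nullary using (¬_; Dec; does; yes; no)
open import Relation.Nullary.Decidable using (¬?; dec-true)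
open import Relation.Nullary.Negation using (contraposition)
open import Relation.Binary.PropositionalEquality using (_≡_; _≢_; refl; sym; trans; subst; cong; ≢-sym)

count-mono : ∀ {n} (f g : Fin n → Bool) → (∀ i → T (f i) → T (g i)) → count f ≤ count g
count-mono {zero}  f g f⇒g = z≤n
count-mono {suc n} f g f⇒g with f zero | g zero | f⇒g zero
... | true  | true  | _     = s≤s (count-mono (f ∘ suc) (g ∘ suc) (f⇒g ∘ suc))
... | true  | false | f0⇒g0 = ⊥-elim (f0⇒g0 tt)
... | false | true  | _     = m≤n⇒m≤1+n (count-mono (f ∘ suc) (g ∘ suc) (f⇒g ∘ suc))
... | false | false | _     = count-mono (f ∘ suc) (g ∘ suc) (f⇒g ∘ suc)

count-remove : ∀ {n} (f : Fin n → Bool) (u : Fin n) → T (f u)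
  → count f ≡ suc (count (λ v → does (¬? (v ≟ u)) ∧ f v))
count-remove f zero fu with f zero
... | true = refl
count-remove f (suc u) fu with f zero
... | true  = cong suc (count-remove (f ∘ suc) u fu)
... | false = count-remove (f ∘ suc) u fu

T-does : ∀ {A : Set} (a? : Dec A) → T (does a?) → A
T-does (yes a) _ = a

T-does⁻ : ∀ {A : Set} (a? : Dec A) → A → T (does a?)
T-does⁻ a? a rewrite dec-true a? a = tt

<⇒≱ : ∀ {x y : ℚ} → x <ℚ y → ¬ (y ≤ℚ x)
<⇒≱ x<y y≤x = <-irrefl refl (<-≤-trans x<y y≤x)

gap-above : ∀ {n} (E : Fin n → ℚ) {a b : ℚ} → a <ℚ b
  → ∃[ p ] (a <ℚ p × p <ℚ b × (∀ i → E i ≤ℚ a ⊎ p <ℚ E i))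
gap-above {zero} E a<b = let p , a<p , p<b = <-dense a<b in p , a<p , p<b , λ ()
gap-above {suc n} E {a} a<b with gap-above (E ∘ suc) a<b | E zero ≤? a
... | p , a<p , p<b , gap | yes e≤a = p , a<p , p<b , λ { zero → inj₁ e≤a ; (suc i) → gap i }
... | p , a<p , p<b , gap | no e≰a with p <? E zero
...   | yes p<e = p , a<p , p<b , λ { zero → inj₂ p<e ; (suc i) → gap i }
...   | no p≮e =
  let p′ , a<p′ , p′<e = <-dense (≰⇒> e≰a)
      p′<p = <-≤-trans p′<e (≮⇒≥ p≮e)
  in p′ , a<p′ , <-trans p′<p p<b
     , λ { zero → inj₂ p′<e ; (suc i) → map₂ (<-trans p′<p) (gap i) }

gap-below : ∀ {n} (E : Fin n → ℚ) {a b : ℚ} → a <ℚ b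
  → ∃[ p ] (a <ℚ p × p <ℚ b × (∀ i → b ≤ℚ E i ⊎ E i <ℚ p))
gap-below {zero} E a<b = let p , a<p , p<b = <-dense a<b in p , a<p , p<b , λ ()
gap-below {suc n} E {b = b} a<b with gap-below (E ∘ suc) a<b | b ≤? E zero
... | p , a<p , p<b , gap | yes b≤e = p , a<p , p<b , λ { zero → inj₁ b≤e ; (suc i) → gap i }
... | p , a<p , p<b , gap | no b≰e with E zero <? p
...   | yes e<p = p , a<p , p<b , λ { zero → inj₂ e<p ; (suc i) → gap i }
...   | no e≮p =
  let p′ , e<p′ , p′<b = <-dense (≰⇒> b≰e)
      p<p′ = ≤-<-trans (≮⇒≥ e≮p) e<p′
  in p′ , <-trans a<p p<p′ , p′<b
     , λ { zero → inj₂ e<p′ ; (suc i) → map₂ (λ e<p → <-trans e<p p<p′) (gap i) }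

arc∋l : ∀ {a} → l a ≢ r a → a ∋ l a
arc∋l {a} l≢r with <-cmp (l a) (r a)
... | tri< l<r _ _ = inj₁ (l<r , ≤-refl , <⇒≤ l<r)
... | tri≈ _ l≡r _ = ⊥-elim (l≢r l≡r)
... | tri> _ _ r<l = inj₂ (r<l , inj₁ ≤-refl)

arc∋r : ∀ {a} → l a ≢ r a → a ∋ r a
arc∋r {a} l≢r with <-cmp (l a) (r a)
... | tri< l<r _ _ = inj₁ (l<r , <⇒≤ l<r , ≤-refl)
... | tri≈ _ l≡r _ = ⊥-elim (l≢r l≡r)
... | tri> _ _ r<l = inj₂ (r<l , inj₂ ≤-refl)

∋-backward : ∀ {a q p} → q <ℚ p → l a ≤ℚ q ⊎ p <ℚ l a → a ∋ p → a ∋ q × r a ≢ q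
∋-backward {a} {q} {p} q<p no-l = λ
  { (inj₁ (l<r , l≤p , p≤r)) → inj₁ (l<r , l≤q l≤p , <⇒≤ (q<r p≤r)) , r≢q (q<r p≤r)
  ; (inj₂ (r<l , inj₁ l≤p)) → inj₂ (r<l , inj₁ (l≤q l≤p)) , <⇒≢ (<-≤-trans r<l (l≤q l≤p))
  ; (inj₂ (r<l , inj₂ p≤r)) → inj₂ (r<l , inj₂ (<⇒≤ (q<r p≤r))) , r≢q (q<r p≤r)
  }
  where
  l≤q : l a ≤ℚ p → l a ≤ℚ q
  l≤q l≤p = [ id , (λ p<l → ⊥-elim (<⇒≱ p<l l≤p)) ]′ no-l
  q<r : p ≤ℚ r a → q <ℚ r a
  q<r = <-≤-trans q<p
  r≢q : q <ℚ r a → r a ≢ q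
  r≢q = ≢-sym ∘ <⇒≢

∋-forward : ∀ {a p q} → p <ℚ q → q ≤ℚ r a ⊎ r a <ℚ p → a ∋ p → a ∋ q × l a ≢ q
∋-forward {a} {p} {q} p<q no-r = λ
  { (inj₁ (l<r , l≤p , p≤r)) → inj₁ (l<r , <⇒≤ (l<q l≤p) , q≤r p≤r) , <⇒≢ (l<q l≤p)
  ; (inj₂ (r<l , inj₁ l≤p)) → inj₂ (r<l , inj₁ (<⇒≤ (l<q l≤p))) , <⇒≢ (l<q l≤p)
  ; (inj₂ (r<l , inj₂ p≤r)) → inj₂ (r<l , inj₂ (q≤r p≤r)) , ≢-sym (<⇒≢ (≤-<-trans (q≤r p≤r) r<l))
  }
  where
  l<q : l a ≤ℚ p → l a <ℚ q
  l<q l≤p = ≤-<-trans l≤p p<q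
  q≤r : p ≤ℚ r a → q ≤ℚ r a
  q≤r p≤r = [ id , (λ r<p → ⊥-elim (<⇒≱ r<p p≤r)) ]′ no-r

∋-wrap : ∀ {a p} → 0ℚ ≤ℚ r a → r a <ℚ p → a ∋ p → a ∋ 0ℚ × l a ≢ 0ℚ
∋-wrap 0≤r r<p (inj₁ (_ , _ , p≤r)) = ⊥-elim (<⇒≱ r<p p≤r)
∋-wrap 0≤r r<p (inj₂ (r<l , inj₁ _)) = inj₂ (r<l , inj₂ 0≤r) , ≢-sym (<⇒≢ (≤-<-trans 0≤r r<l))
∋-wrap 0≤r r<p (inj₂ (_ , inj₂ p≤r)) = ⊥-elim (<⇒≱ r<p p≤r)

otherOverlapCount : ∀ {n} → (Fin n → Arc) → Fin n → ℚ → ℕ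
otherOverlapCount F u q = count (λ v → does (¬? (v ≟ u)) ∧ does (F v ∋? q))

Overlap⊆Without : ∀ {n} → (Fin n → Arc) → Fin n → ℚ → ℚ → Set
Overlap⊆Without F u p q = ∀ v → F v ∋ p → F v ∋ q × v ≢ u

overlapCount≡suc-otherOverlapCount : ∀ {n} (F : Fin n → Arc) (u : Fin n) {q}
  → F u ∋ q → overlapCount F q ≡ suc (otherOverlapCount F u q)
overlapCount≡suc-otherOverlapCount F u {q} q∈u =
  count-remove (λ v → does (F v ∋? q)) u (T-does⁻ (F u ∋? q) q∈u)

otherOverlapCount≤rsup∸1 : ∀ {n} (F : Fin n → Arc) (u : Fin n) {rsup q} → IsRsup F rsup
  → OnCircle q → F u ∋ q → otherOverlapCount F u q ≤ rsup ∸ 1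
otherOverlapCount≤rsup∸1 F u {q = q} (bounded , _) q-on q∈u = ∸-monoˡ-≤ 1 (begin
  suc (otherOverlapCount F u q) ≡⟨ overlapCount≡suc-otherOverlapCount F u q∈u ⟨
  overlapCount F q              ≤⟨ bounded q q-on ⟩
  _                             ∎)
  where open ℕₚ.≤-Reasoning

rinf≤otherOverlapCount : ∀ {n} {F : Fin n → Arc} {rinf u q} → IsRinf F rinf
  → ∃[ p ] (OnCircle p × Overlap⊆Without F u p q) → rinf ≤ otherOverlapCount F u q
rinf≤otherOverlapCount {F = F} {u = u} {q} (bounded , _) (p , p-on , O⊆) =
  ℕₚ.≤-trans (bounded p p-on) (count-mono _ _ λ v p∈v →
    let q∈v , v≢u = O⊆ v (T-does (F v ∋? p) p∈v)
    in Equivalence.from T-∧ (T-does⁻ (¬? (v ≟ u)) v≢u , T-does⁻ (F v ∋? q) q∈v))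

overlap-after-right : ∀ {n} (F : Fin n → Arc) (u : Fin n) → OnCircle (r (F u))
  → ∃[ p ] (OnCircle p × Overlap⊆Without F u p (r (F u)))
overlap-after-right F u (0≤q , q<1) =
  let p , q<p , p<1 , gap = gap-above (l ∘ F) q<1
  in p , (<⇒≤ (≤-<-trans 0≤q q<p) , p<1) , λ v p∈v →
       let q∈v , r≢q = ∋-backward q<p (gap v) p∈v
       in q∈v , contraposition (cong (r ∘ F)) r≢q

overlap-before-left : ∀ {n} (F : Fin n → Arc) (u : Fin n) → (∀ v → OnCircle (r (F v)))
  → OnCircle (l (F u)) → ∃[ p ] (OnCircle p × Overlap⊆Without F u p (l (F u)))
overlap-before-left F u r-on (0≤q , q<1) with 0ℚ <? l (F u)
... | yes 0<q =
  let p , 0<p , p<q , gap = gap-below (r ∘ F) 0<q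
  in p , (<⇒≤ 0<p , <-trans p<q q<1) , λ v p∈v →
       let q∈v , l≢q = ∋-forward p<q (gap v) p∈v
       in q∈v , contraposition (cong (l ∘ F)) l≢q
... | no 0≮q =
  let q≡0 = ≤-antisym (≮⇒≥ 0≮q) 0≤q
      p , 0<p , p<1 , gap = gap-below (r ∘ F) (positive⁻¹ 1ℚ)
      r<p v = [ (λ 1≤r → ⊥-elim (<⇒≱ (proj₂ (r-on v)) 1≤r)) , id ]′ (gap v)
  in p , (<⇒≤ 0<p , p<1) , λ v p∈v →
       let 0∈v , l≢0 = ∋-wrap (proj₁ (r-on v)) (r<p v) p∈v
       in subst (F v ∋_) (sym q≡0) 0∈v
        , contraposition (λ v≡u → trans (cong (l ∘ F) v≡u) q≡0) l≢0

lemma2p4 : (n : ℕ) (F : Fin n → Arc) → ProperFamily F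
    → (rsup rinf : ℕ) → IsRsup F rsup → IsRinf F rinf
    → (u : Fin n)
    → (cwAdjCount F u ≤ rsup ∸ 1 × rinf ≤ cwAdjCount F u)
      × (acwAdjCount F u ≤ rsup ∸ 1 × rinf ≤ acwAdjCount F u)
lemma2p4 n F PF rsup rinf sup inf u =
  ( otherOverlapCount≤rsup∸1 F u sup (r-on u) (arc∋r (lr-distinct u u))
  , rinf≤otherOverlapCount inf (overlap-after-right F u (r-on u)) )
  , ( otherOverlapCount≤rsup∸1 F u sup (l-on u) (arc∋l (lr-distinct u u))
    , rinf≤otherOverlapCount inf (overlap-before-left F u r-on (l-on u)) )
  where open ProperFamily PF
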